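{- Let $m\in\mathbb{N}$ be odd and $n\in\mathbb{N}_0$. Then $$(m^{n}-m)G_{n}=\sum_{k=0}^{n}\binom{n}{k}m^{k}G_{k}\,Z_{n-k}(m-1).$$
   Context: Genocchi numbers: $\frac{2t}{e^{t}+1}=\sum_{n\ge0}G_{n}\frac{t^{n}}{n!}$. For $m,k\in\mathbb{N}_0$, $Z_{k}(m)=\sum_{j=1}^{m}(-1)^{j+1}j^{k}$. -}

module Defs where

open import Data.Nat as ℕ using (ℕ; zero; suc)
open import Data.Nat.Combinatorics using (_C_)
open import Data.Integer as ℤ using (ℤ; +_)
open import Data.Rational as ℚ using (ℚ; ½; 0ℚ; _/_)
open import Data.List using (List; []; _∷_; _++_; [_]; lookup; length)
open import Data.Maybe using (Maybe; just; nothing)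

sumℚ : ℕ → (ℕ → ℚ) → ℚ
sumℚ zero    f = f 0
sumℚ (suc n) f = sumℚ n f ℚ.+ f (suc n)

ℕtoℚ : ℕ → ℚ
ℕtoℚ n = + n / 1

ℤtoℚ : ℤ → ℚ
ℤtoℚ z = z / 1

-- Genocchi numbers, 2t/(e^t+1) = Σ G_n t^n/n!.
-- Multiplying by (e^t + 1) and comparing coefficients of t^n/n!:
--   Σ_{k=0}^{n} C(n,k) G_k + G_n = 2·[n = 1],
-- i.e. G_n = ½ (2·[n=1] − Σ_{k<n} C(n,k) G_k).
-- genocchiList n = [G_0, …, G_{n-1}].

private
  at : List ℚ → ℕ → ℚ
  at []       _       = 0ℚ
  at (x ∷ xs) zero    = x
  at (x ∷ xs) (suc k) = at xs k

  sumBelow : ℕ → List ℚ → ℚ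
  sumBelow zero    gs = 0ℚ
  sumBelow (suc n) gs = sumℚ n (λ k → ℕtoℚ (suc n C k) ℚ.* at gs k)

  delta1 : ℕ → ℚ
  delta1 1 = ℕtoℚ 2
  delta1 _ = 0ℚ

genocchiList : ℕ → List ℚ
genocchiList zero    = []
genocchiList (suc n) =
  genocchiList n ++ [ ½ ℚ.* (delta1 n ℚ.- sumBelow n (genocchiList n)) ]

G : ℕ → ℚ
G n = at (genocchiList (suc n)) n

Z : ℕ → ℕ → ℤ
Z k zero    = + 0
Z k (suc m) = Z k m ℤ.+ sign m ℤ.* (+ (suc m ℕ.^ k))
  where
  sign : ℕ → ℤ   -- (-1)^{(m+1)+1} = (-1)^m
  sign zero          = + 1
  sign (suc zero)    = ℤ.- (+ 1)
  sign (suc (suc j)) = sign j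

{-# OPTIONS --safe #-}
-- Read sequences as exponential generating functions, so that binomial convolution becomes
-- multiplication of series. For m = M + 1 odd, the series Z(t) = Σₖ Zₖ(M) tᵏ/k! is
-- Σ_{j=1}^{M} (-1)^{j+1} e^{jt}, and Z(t)(eᵗ + 1) telescopes to eᵗ − e^{mt}; moreover
-- G(mt)(e^{mt} + 1) = 2mt = m G(t)(eᵗ + 1). Hence G(mt) Z(t) and G(mt) − m G(t) agree after
-- multiplication by eᵗ + 1, and eᵗ + 1 is cancellable since its constant term 2 is invertible.
module Submission where

open import Defs
open import Data.Nat as ℕ using (ℕ; zero; suc; _∸_; _≤_; _<_; z≤n; s≤s)
open import Data.Nat.Combinatorics using (_C_; nCn≡1; k>n⇒nCk≡0; nCk+nC[k+1]≡[n+1]C[k+1])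
open import Data.Nat.DivMod using (_%_; _/_; m≡m%n+[m/n]*n)
import Data.Nat.Properties as ℕP
open import Data.Integer as ℤ using (ℤ; +_)
import Data.Integer.Properties as ℤP
open import Data.Rational as ℚ using (ℚ; 0ℚ; 1ℚ; ½; _+_; _*_; -_; _-_)
import Data.Rational.Properties as ℚP
open import Data.Rational.Unnormalised as ℚᵘ using (mkℚᵘ; *≡*)
import Data.Rational.Unnormalised.Properties as ℚᵘP
open import Algebra.Bundles using (Ring)
open import Data.Rational.Solver using (module +-*-Solver)
open import Algebra.Properties.Semiring.Exp (Ring.semiring ℚP.+-*-ring) using (_^_; ^-homo-*)
open import Data.List using (List; []; _∷_; _++_; [_]; length)
import Data.List.Properties as ListP
open import Data.Sum using (inj₁; inj₂)
open import Relation.Binary.PropositionalEquality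
  using (_≡_; _≗_; refl; sym; trans; cong; cong₂; module ≡-Reasoning)
open +-*-Solver

toℚᵘ-ℤtoℚ : ∀ z → ℚ.toℚᵘ (ℤtoℚ z) ℚᵘ.≃ mkℚᵘ z 0
toℚᵘ-ℤtoℚ z = ℚP.toℚᵘ-fromℚᵘ (mkℚᵘ z 0)

ℤtoℚ-homo-+ : ∀ a b → ℤtoℚ (a ℤ.+ b) ≡ ℤtoℚ a + ℤtoℚ b
ℤtoℚ-homo-+ a b = ℚP.toℚᵘ-injective (begin
    ℚ.toℚᵘ (ℤtoℚ (a ℤ.+ b))                 ≈⟨ toℚᵘ-ℤtoℚ (a ℤ.+ b) ⟩
    mkℚᵘ (a ℤ.+ b) 0                         ≈⟨ *≡* integral ⟩
    mkℚᵘ a 0 ℚᵘ.+ mkℚᵘ b 0                   ≈⟨ ℚᵘP.+-cong (toℚᵘ-ℤtoℚ a) (toℚᵘ-ℤtoℚ b) ⟨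
    ℚ.toℚᵘ (ℤtoℚ a) ℚᵘ.+ ℚ.toℚᵘ (ℤtoℚ b)     ≈⟨ ℚP.toℚᵘ-homo-+ (ℤtoℚ a) (ℤtoℚ b) ⟨
    ℚ.toℚᵘ (ℤtoℚ a + ℤtoℚ b)                 ∎)
  where
  open ℚᵘP.≃-Reasoning
  integral : (a ℤ.+ b) ℤ.* + 1 ≡ (a ℤ.* + 1 ℤ.+ b ℤ.* + 1) ℤ.* + 1
  integral = cong (ℤ._* + 1) (sym (cong₂ ℤ._+_ (ℤP.*-identityʳ a) (ℤP.*-identityʳ b)))

ℤtoℚ-homo-* : ∀ a b → ℤtoℚ (a ℤ.* b) ≡ ℤtoℚ a * ℤtoℚ b
ℤtoℚ-homo-* a b = ℚP.toℚᵘ-injective (begin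
    ℚ.toℚᵘ (ℤtoℚ (a ℤ.* b))                 ≈⟨ toℚᵘ-ℤtoℚ (a ℤ.* b) ⟩
    mkℚᵘ a 0 ℚᵘ.* mkℚᵘ b 0                   ≈⟨ ℚᵘP.*-cong (toℚᵘ-ℤtoℚ a) (toℚᵘ-ℤtoℚ b) ⟨
    ℚ.toℚᵘ (ℤtoℚ a) ℚᵘ.* ℚ.toℚᵘ (ℤtoℚ b)     ≈⟨ ℚP.toℚᵘ-homo-* (ℤtoℚ a) (ℤtoℚ b) ⟨
    ℚ.toℚᵘ (ℤtoℚ a * ℤtoℚ b)                 ∎)
  where open ℚᵘP.≃-Reasoning

ℕtoℚ-homo-+ : ∀ a b → ℕtoℚ (a ℕ.+ b) ≡ ℕtoℚ a + ℕtoℚ b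
ℕtoℚ-homo-+ a b = trans (cong ℤtoℚ (ℤP.pos-+ a b)) (ℤtoℚ-homo-+ (+ a) (+ b))

ℕtoℚ-homo-* : ∀ a b → ℕtoℚ (a ℕ.* b) ≡ ℕtoℚ a * ℕtoℚ b
ℕtoℚ-homo-* a b = trans (cong ℤtoℚ (ℤP.pos-* a b)) (ℤtoℚ-homo-* (+ a) (+ b))

ℕtoℚ-homo-^ : ∀ a n → ℕtoℚ (a ℕ.^ n) ≡ ℕtoℚ a ^ n
ℕtoℚ-homo-^ a zero    = refl
ℕtoℚ-homo-^ a (suc n) = trans (ℕtoℚ-homo-* a (a ℕ.^ n)) (cong (ℕtoℚ a *_) (ℕtoℚ-homo-^ a n))

1^n≡1 : ∀ n → 1ℚ ^ n ≡ 1ℚ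
1^n≡1 zero    = refl
1^n≡1 (suc n) = trans (ℚP.*-identityˡ (1ℚ ^ n)) (1^n≡1 n)

sumℚ-cong : ∀ n {f g : ℕ → ℚ} → (∀ k → k ≤ n → f k ≡ g k) → sumℚ n f ≡ sumℚ n g
sumℚ-cong zero    f≡g = f≡g 0 z≤n
sumℚ-cong (suc n) f≡g =
  cong₂ _+_ (sumℚ-cong n (λ k k≤n → f≡g k (ℕP.m≤n⇒m≤1+n k≤n))) (f≡g (suc n) ℕP.≤-refl)

sumℚ-+ : ∀ n (f g : ℕ → ℚ) → sumℚ n (λ k → f k + g k) ≡ sumℚ n f + sumℚ n g
sumℚ-+ zero    f g = refl
sumℚ-+ (suc n) f g = trans (cong (_+ (f (suc n) + g (suc n))) (sumℚ-+ n f g))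
  (solve 4 (λ a b c d → (a :+ b) :+ (c :+ d) := (a :+ c) :+ (b :+ d)) refl
     (sumℚ n f) (sumℚ n g) (f (suc n)) (g (suc n)))

sumℚ-*ˡ : ∀ n c (f : ℕ → ℚ) → sumℚ n (λ k → c * f k) ≡ c * sumℚ n f
sumℚ-*ˡ zero    c f = refl
sumℚ-*ˡ (suc n) c f =
  trans (cong (_+ (c * f (suc n))) (sumℚ-*ˡ n c f)) (sym (ℚP.*-distribˡ-+ c _ _))

sumℚ-suc : ∀ n (f : ℕ → ℚ) → sumℚ (suc n) f ≡ f 0 + sumℚ n (λ k → f (suc k))
sumℚ-suc zero    f = refl
sumℚ-suc (suc n) f = trans (cong (_+ f (suc (suc n))) (sumℚ-suc n f)) (ℚP.+-assoc (f 0) _ _)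

-- A sequence f stands for the exponential generating function Σ f n tⁿ/n!: then _⊛_ is the
-- product of series, δ is d/dt, expSeq x is e^{xt} and dilate x f is f(xt).
Seq : Set
Seq = ℕ → ℚ

infixl 6 _⊕_
infixl 7 _·_ _⊛_

_⊕_ : Seq → Seq → Seq
(f ⊕ g) n = f n + g n

_·_ : ℚ → Seq → Seq
(c · f) n = c * f n

δ : Seq → Seq
δ f n = f (suc n)

_⊛_ : Seq → Seq → Seq
(f ⊛ g) n = sumℚ n (λ k → ℕtoℚ (n C k) * f k * g (n ∸ k))

expSeq : ℚ → Seq
expSeq x n = x ^ n

⊛-cong : ∀ {f f′ g g′} → f ≗ f′ → g ≗ g′ → f ⊛ g ≗ f′ ⊛ g′
⊛-cong f≗f′ g≗g′ n =
  sumℚ-cong n (λ k _ → cong₂ (λ a b → ℕtoℚ (n C k) * a * b) (f≗f′ k) (g≗g′ (n ∸ k)))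

⊛-distribʳ-⊕ : ∀ f f′ g → (f ⊕ f′) ⊛ g ≗ f ⊛ g ⊕ f′ ⊛ g
⊛-distribʳ-⊕ f f′ g n = trans (sumℚ-cong n (λ k _ →
    solve 4 (λ c a b d → c :* (a :+ b) :* d := c :* a :* d :+ c :* b :* d) refl
      (ℕtoℚ (n C k)) (f k) (f′ k) (g (n ∸ k))))
  (sumℚ-+ n _ _)

⊛-distribˡ-⊕ : ∀ f g g′ → f ⊛ (g ⊕ g′) ≗ f ⊛ g ⊕ f ⊛ g′
⊛-distribˡ-⊕ f g g′ n = trans (sumℚ-cong n (λ k _ →
    solve 4 (λ c a b d → c :* d :* (a :+ b) := c :* d :* a :+ c :* d :* b) refl
      (ℕtoℚ (n C k)) (g (n ∸ k)) (g′ (n ∸ k)) (f k)))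
  (sumℚ-+ n _ _)

⊛-·ˡ : ∀ c f g → (c · f) ⊛ g ≗ c · (f ⊛ g)
⊛-·ˡ c f g n = trans (sumℚ-cong n (λ k _ →
    solve 4 (λ x c a b → x :* (c :* a) :* b := c :* (x :* a :* b)) refl
      (ℕtoℚ (n C k)) c (f k) (g (n ∸ k))))
  (sumℚ-*ˡ n c _)

⊛-·ʳ : ∀ c f g → f ⊛ (c · g) ≗ c · (f ⊛ g)
⊛-·ʳ c f g n = trans (sumℚ-cong n (λ k _ →
    solve 4 (λ x c a b → x :* a :* (c :* b) := c :* (x :* a :* b)) refl
      (ℕtoℚ (n C k)) c (f k) (g (n ∸ k))))
  (sumℚ-*ˡ n c _)

module _ (f g : Seq) where
  private
    shiftedPascal : Seq
    shiftedPascal n = sumℚ n (λ k → ℕtoℚ (n C suc k) * f (suc k) * g (n ∸ k))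

    ⊛-δʳ : ∀ n → (f ⊛ δ g) n ≡ f 0 * g (suc n) + shiftedPascal n
    ⊛-δʳ zero = solve 4 (λ a b c d → con 1ℚ :* a :* b := a :* b :+ con 0ℚ :* c :* d) refl
      (f 0) (g 1) (f 1) (g 0)
    ⊛-δʳ (suc n) = begin
        (f ⊛ δ g) (suc n)
      ≡⟨ sumℚ-suc n _ ⟩
        1ℚ * f 0 * g (suc (suc n)) + sumℚ n (λ k → ℕtoℚ (suc n C suc k) * f (suc k) * g (suc (n ∸ k)))
      ≡⟨ cong₂ _+_ (cong (_* g (suc (suc n))) (ℚP.*-identityˡ (f 0)))
           (sumℚ-cong n (λ k k≤n → cong (λ j → ℕtoℚ (suc n C suc k) * f (suc k) * g j)
             (sym (ℕP.+-∸-assoc 1 k≤n)))) ⟩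
        f 0 * g (suc (suc n)) + sumℚ n (λ k → ℕtoℚ (suc n C suc k) * f (suc k) * g (suc n ∸ k))
      ≡⟨ cong (_+_ (f 0 * g (suc (suc n)))) (sym (trans (cong (_+_ lower) vanishingTop) (ℚP.+-identityʳ lower))) ⟩
        f 0 * g (suc (suc n)) + shiftedPascal (suc n)
      ∎
      where
      open ≡-Reasoning
      lower : ℚ
      lower = sumℚ n (λ k → ℕtoℚ (suc n C suc k) * f (suc k) * g (suc n ∸ k))
      vanishingTop : ℕtoℚ (suc n C suc (suc n)) * f (suc (suc n)) * g (n ∸ n) ≡ 0ℚ
      vanishingTop rewrite k>n⇒nCk≡0 (ℕP.n<1+n (suc n)) =
        trans (cong (_* g (n ∸ n)) (ℚP.*-zeroˡ (f (suc (suc n))))) (ℚP.*-zeroˡ (g (n ∸ n)))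

  ⊛-leibniz : δ (f ⊛ g) ≗ δ f ⊛ g ⊕ f ⊛ δ g
  ⊛-leibniz n = begin
      (f ⊛ g) (suc n)
    ≡⟨ sumℚ-suc n _ ⟩
      1ℚ * f 0 * g (suc n) + sumℚ n (λ k → ℕtoℚ (suc n C suc k) * f (suc k) * g (n ∸ k))
    ≡⟨ cong (_+_ (1ℚ * f 0 * g (suc n))) (trans (sumℚ-cong n (λ k _ → pascal k)) (sumℚ-+ n _ _)) ⟩
      1ℚ * f 0 * g (suc n) + ((δ f ⊛ g) n + shiftedPascal n)
    ≡⟨ solve 4 (λ a b c d → con 1ℚ :* a :* b :+ (c :+ d) := c :+ (a :* b :+ d)) refl
         (f 0) (g (suc n)) ((δ f ⊛ g) n) (shiftedPascal n) ⟩
      (δ f ⊛ g) n + (f 0 * g (suc n) + shiftedPascal n)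
    ≡⟨ cong (_+_ ((δ f ⊛ g) n)) (sym (⊛-δʳ n)) ⟩
      (δ f ⊛ g ⊕ f ⊛ δ g) n
    ∎
    where
    open ≡-Reasoning
    pascal : ∀ k → ℕtoℚ (suc n C suc k) * f (suc k) * g (n ∸ k)
                 ≡ ℕtoℚ (n C k) * f (suc k) * g (n ∸ k) + ℕtoℚ (n C suc k) * f (suc k) * g (n ∸ k)
    pascal k = begin
        ℕtoℚ (suc n C suc k) * f (suc k) * g (n ∸ k)
      ≡⟨ cong (λ c → ℕtoℚ c * f (suc k) * g (n ∸ k)) (sym (nCk+nC[k+1]≡[n+1]C[k+1] n k)) ⟩
        ℕtoℚ (n C k ℕ.+ n C suc k) * f (suc k) * g (n ∸ k)
      ≡⟨ cong (λ c → c * f (suc k) * g (n ∸ k)) (ℕtoℚ-homo-+ (n C k) (n C suc k)) ⟩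
        (ℕtoℚ (n C k) + ℕtoℚ (n C suc k)) * f (suc k) * g (n ∸ k)
      ≡⟨ solve 4 (λ a b c d → (a :+ b) :* c :* d := a :* c :* d :+ b :* c :* d) refl
           (ℕtoℚ (n C k)) (ℕtoℚ (n C suc k)) (f (suc k)) (g (n ∸ k)) ⟩
        ℕtoℚ (n C k) * f (suc k) * g (n ∸ k) + ℕtoℚ (n C suc k) * f (suc k) * g (n ∸ k)
      ∎

⊛-assoc : ∀ f g h → (f ⊛ g) ⊛ h ≗ f ⊛ (g ⊛ h)
⊛-assoc f g h zero =
  solve 3 (λ a b c → con 1ℚ :* (con 1ℚ :* a :* b) :* c := con 1ℚ :* a :* (con 1ℚ :* b :* c)) refl
    (f 0) (g 0) (h 0)
⊛-assoc f g h (suc n) = begin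
    ((f ⊛ g) ⊛ h) (suc n)
  ≡⟨ ⊛-leibniz (f ⊛ g) h n ⟩
    (δ (f ⊛ g) ⊛ h) n + ((f ⊛ g) ⊛ δ h) n
  ≡⟨ cong (_+ ((f ⊛ g) ⊛ δ h) n)
       (trans (⊛-cong {g = h} (⊛-leibniz f g) (λ _ → refl) n) (⊛-distribʳ-⊕ (δ f ⊛ g) (f ⊛ δ g) h n)) ⟩
    ((δ f ⊛ g) ⊛ h) n + ((f ⊛ δ g) ⊛ h) n + ((f ⊛ g) ⊛ δ h) n
  ≡⟨ cong₂ _+_ (cong₂ _+_ (⊛-assoc (δ f) g h n) (⊛-assoc f (δ g) h n)) (⊛-assoc f g (δ h) n) ⟩
    (δ f ⊛ (g ⊛ h)) n + (f ⊛ (δ g ⊛ h)) n + (f ⊛ (g ⊛ δ h)) n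
  ≡⟨ ℚP.+-assoc ((δ f ⊛ (g ⊛ h)) n) ((f ⊛ (δ g ⊛ h)) n) ((f ⊛ (g ⊛ δ h)) n) ⟩
    (δ f ⊛ (g ⊛ h)) n + ((f ⊛ (δ g ⊛ h)) n + (f ⊛ (g ⊛ δ h)) n)
  ≡⟨ cong (_+_ ((δ f ⊛ (g ⊛ h)) n))
       (trans (sym (⊛-distribˡ-⊕ f (δ g ⊛ h) (g ⊛ δ h) n))
              (⊛-cong {f = f} (λ _ → refl) (λ k → sym (⊛-leibniz g h k)) n)) ⟩
    (δ f ⊛ (g ⊛ h)) n + (f ⊛ δ (g ⊛ h)) n
  ≡⟨ sym (⊛-leibniz f (g ⊛ h) n) ⟩
    (f ⊛ (g ⊛ h)) (suc n)
  ∎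
  where open ≡-Reasoning

expSeq-⊛ : ∀ x y → expSeq x ⊛ expSeq y ≗ expSeq (x + y)
expSeq-⊛ x y zero    = ℚP.*-identityʳ (1ℚ * 1ℚ)
expSeq-⊛ x y (suc n) = begin
    (expSeq x ⊛ expSeq y) (suc n)
  ≡⟨ ⊛-leibniz (expSeq x) (expSeq y) n ⟩
    ((x · expSeq x) ⊛ expSeq y) n + (expSeq x ⊛ (y · expSeq y)) n
  ≡⟨ cong₂ _+_ (⊛-·ˡ x (expSeq x) (expSeq y) n) (⊛-·ʳ y (expSeq x) (expSeq y) n) ⟩
    x * (expSeq x ⊛ expSeq y) n + y * (expSeq x ⊛ expSeq y) n
  ≡⟨ sym (ℚP.*-distribʳ-+ _ x y) ⟩
    (x + y) * (expSeq x ⊛ expSeq y) n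
  ≡⟨ cong ((x + y) *_) (expSeq-⊛ x y n) ⟩
    expSeq (x + y) (suc n)
  ∎
  where open ≡-Reasoning

infixl 7 _⊛[eᵗ+1]

_⊛[eᵗ+1] : Seq → Seq
f ⊛[eᵗ+1] = f ⊛ expSeq 1ℚ ⊕ f

⊛[eᵗ+1]-⊕ : ∀ f g → (f ⊕ g) ⊛[eᵗ+1] ≗ f ⊛[eᵗ+1] ⊕ g ⊛[eᵗ+1]
⊛[eᵗ+1]-⊕ f g n = trans (cong (_+ (f n + g n)) (⊛-distribʳ-⊕ f g (expSeq 1ℚ) n))
  (solve 4 (λ a b c d → (a :+ b) :+ (c :+ d) := (a :+ c) :+ (b :+ d)) refl
    ((f ⊛ expSeq 1ℚ) n) ((g ⊛ expSeq 1ℚ) n) (f n) (g n))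

⊛[eᵗ+1]-· : ∀ c f → (c · f) ⊛[eᵗ+1] ≗ c · (f ⊛[eᵗ+1])
⊛[eᵗ+1]-· c f n = trans (cong (_+ c * f n) (⊛-·ˡ c f (expSeq 1ℚ) n))
  (sym (ℚP.*-distribˡ-+ c _ _))

⊛-⊛[eᵗ+1] : ∀ f g → (f ⊛ g) ⊛[eᵗ+1] ≗ f ⊛ (g ⊛[eᵗ+1])
⊛-⊛[eᵗ+1] f g n = trans (cong (_+ (f ⊛ g) n) (⊛-assoc f g (expSeq 1ℚ) n))
  (sym (⊛-distribˡ-⊕ f (g ⊛ expSeq 1ℚ) g n))

expSeq-⊛[eᵗ+1] : ∀ x → expSeq x ⊛[eᵗ+1] ≗ expSeq (x + 1ℚ) ⊕ expSeq x
expSeq-⊛[eᵗ+1] x n = cong (_+ expSeq x n) (expSeq-⊛ x 1ℚ n)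

binomialSumBelow : Seq → Seq
binomialSumBelow f zero    = 0ℚ
binomialSumBelow f (suc n) = sumℚ n (λ k → ℕtoℚ (suc n C k) * f k)

⊛[eᵗ+1]-split : ∀ f n → (f ⊛[eᵗ+1]) n ≡ binomialSumBelow f n + (f n + f n)
⊛[eᵗ+1]-split f zero    = solve 1 (λ a → con 1ℚ :* a :* con 1ℚ :+ a := con 0ℚ :+ (a :+ a)) refl (f 0)
⊛[eᵗ+1]-split f (suc n) = begin
    sumℚ n (λ k → ℕtoℚ (suc n C k) * f k * 1ℚ ^ (suc n ∸ k))
      + ℕtoℚ (suc n C suc n) * f (suc n) * 1ℚ ^ (n ∸ n) + f (suc n)
  ≡⟨ cong₂ (λ s c → s + c * f (suc n) * 1ℚ ^ (n ∸ n) + f (suc n))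
       (sumℚ-cong n (λ k _ → trans (cong (ℕtoℚ (suc n C k) * f k *_) (1^n≡1 (suc n ∸ k)))
                                   (ℚP.*-identityʳ _)))
       (cong ℕtoℚ (nCn≡1 (suc n))) ⟩
    binomialSumBelow f (suc n) + 1ℚ * f (suc n) * 1ℚ ^ (n ∸ n) + f (suc n)
  ≡⟨ cong (λ p → binomialSumBelow f (suc n) + 1ℚ * f (suc n) * p + f (suc n)) (1^n≡1 (n ∸ n)) ⟩
    binomialSumBelow f (suc n) + 1ℚ * f (suc n) * 1ℚ + f (suc n)
  ≡⟨ solve 2 (λ s a → s :+ con 1ℚ :* a :* con 1ℚ :+ a := s :+ (a :+ a)) refl
       (binomialSumBelow f (suc n)) (f (suc n)) ⟩
    binomialSumBelow f (suc n) + (f (suc n) + f (suc n))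
  ∎
  where open ≡-Reasoning

binomialSumBelow-cong : ∀ {f g} n → (∀ k → k < n → f k ≡ g k) → binomialSumBelow f n ≡ binomialSumBelow g n
binomialSumBelow-cong zero    f≡g = refl
binomialSumBelow-cong (suc n) f≡g = sumℚ-cong n (λ k k≤n → cong (ℕtoℚ (suc n C k) *_) (f≡g k (s≤s k≤n)))

⊛[eᵗ+1]-injective : ∀ {f g} → f ⊛[eᵗ+1] ≗ g ⊛[eᵗ+1] → f ≗ g
⊛[eᵗ+1]-injective {f} {g} eq n = agreeBelow (suc n) n ℕP.≤-refl
  where
  halve : ∀ s x y → s + (x + x) ≡ s + (y + y) → x ≡ y
  halve s x y e = begin
      x                     ≡⟨ solve 2 (λ s x → x := con ½ :* ((s :+ (x :+ x)) :- s)) refl s x ⟩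
      ½ * (s + (x + x) - s) ≡⟨ cong (λ t → ½ * (t - s)) e ⟩
      ½ * (s + (y + y) - s) ≡⟨ solve 2 (λ s y → con ½ :* ((s :+ (y :+ y)) :- s) := y) refl s y ⟩
      y                     ∎
    where open ≡-Reasoning

  agreeBelow : ∀ n k → k < n → f k ≡ g k
  agreeBelow (suc n) k (s≤s k≤n) with ℕP.m≤n⇒m<n∨m≡n k≤n
  ... | inj₁ k<n = agreeBelow n k k<n
  ... | inj₂ refl = halve (binomialSumBelow f k) (f k) (g k) (begin
      binomialSumBelow f k + (f k + f k) ≡⟨ sym (⊛[eᵗ+1]-split f k) ⟩
      (f ⊛[eᵗ+1]) k                       ≡⟨ eq k ⟩
      (g ⊛[eᵗ+1]) k                       ≡⟨ ⊛[eᵗ+1]-split g k ⟩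
      binomialSumBelow g k + (g k + g k)  ≡⟨ cong (_+ (g k + g k)) (sym (binomialSumBelow-cong k (agreeBelow k))) ⟩
      binomialSumBelow f k + (g k + g k)  ∎)
    where open ≡-Reasoning

dilate : ℚ → Seq → Seq
dilate x f n = x ^ n * f n

dilate-⊛ : ∀ x f g → dilate x f ⊛ dilate x g ≗ dilate x (f ⊛ g)
dilate-⊛ x f g n = trans (sumℚ-cong n collectPowers) (sumℚ-*ˡ n (x ^ n) _)
  where
  collectPowers : ∀ k → k ≤ n → ℕtoℚ (n C k) * (x ^ k * f k) * (x ^ (n ∸ k) * g (n ∸ k))
                              ≡ x ^ n * (ℕtoℚ (n C k) * f k * g (n ∸ k))
  collectPowers k k≤n = trans
    (solve 5 (λ c p a q b → c :* (p :* a) :* (q :* b) := (p :* q) :* (c :* a :* b)) refl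
      (ℕtoℚ (n C k)) (x ^ k) (f k) (x ^ (n ∸ k)) (g (n ∸ k)))
    (cong (_* (ℕtoℚ (n C k) * f k * g (n ∸ k)))
      (trans (sym (^-homo-* x k (n ∸ k))) (cong (x ^_) (ℕP.m+[n∸m]≡n k≤n))))

dilate-expSeq-1 : ∀ x → dilate x (expSeq 1ℚ) ≗ expSeq x
dilate-expSeq-1 x n = trans (cong (x ^ n *_) (1^n≡1 n)) (ℚP.*-identityʳ (x ^ n))

dilate-⊛[eᵗ+1] : ∀ x f → dilate x f ⊛ expSeq x ⊕ dilate x f ≗ dilate x (f ⊛[eᵗ+1])
dilate-⊛[eᵗ+1] x f n = trans
  (cong (_+ dilate x f n)
    (trans (⊛-cong {f = dilate x f} (λ _ → refl) (λ k → sym (dilate-expSeq-1 x k)) n)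
           (dilate-⊛ x f (expSeq 1ℚ) n)))
  (sym (ℚP.*-distribˡ-+ (x ^ n) _ _))

2t : Seq
2t zero          = 0ℚ
2t (suc zero)    = ℕtoℚ 2
2t (suc (suc n)) = 0ℚ

dilate-2t : ∀ x → dilate x 2t ≗ x · 2t
dilate-2t x zero          = trans (ℚP.*-zeroʳ 1ℚ) (sym (ℚP.*-zeroʳ x))
dilate-2t x (suc zero)    = cong (_* ℕtoℚ 2) (ℚP.*-identityʳ x)
dilate-2t x (suc (suc n)) = trans (ℚP.*-zeroʳ (x ^ suc (suc n))) (sym (ℚP.*-zeroʳ x))

-- Defs keeps the list lookup behind G private; the meta is solved to it by unifying with the
-- unfolding of G.
mutual
  lookupℚ : List ℚ → ℕ → ℚ
  lookupℚ = _

  G-lookup : ∀ n → G n ≡ lookupℚ (genocchiList (suc n)) n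
  G-lookup n with genocchiList (suc n)
  ... | _ = refl

genocchiList-length : ∀ n → length (genocchiList n) ≡ n
genocchiList-length zero    = refl
genocchiList-length (suc n) = trans (ListP.length-++ (genocchiList n))
  (trans (cong (ℕ._+ 1) (genocchiList-length n)) (ℕP.+-comm n 1))

lookupℚ-snoc : ∀ xs y {k} → length xs ≡ k → lookupℚ (xs ++ [ y ]) k ≡ y
lookupℚ-snoc []       y refl = refl
lookupℚ-snoc (x ∷ xs) y refl = lookupℚ-snoc xs y refl

lookupℚ-++ : ∀ xs ys {k} → k < length xs → lookupℚ (xs ++ ys) k ≡ lookupℚ xs k
lookupℚ-++ (x ∷ xs) ys {zero}  _         = refl
lookupℚ-++ (x ∷ xs) ys {suc k} (s≤s k<n) = lookupℚ-++ xs ys k<n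

lookupℚ-genocchiList : ∀ n k → k < n → lookupℚ (genocchiList n) k ≡ G k
lookupℚ-genocchiList (suc n) k (s≤s k≤n) with ℕP.m≤n⇒m<n∨m≡n k≤n
... | inj₁ k<n = trans
  (lookupℚ-++ (genocchiList n) _ (ℕP.<-≤-trans k<n (ℕP.≤-reflexive (sym (genocchiList-length n)))))
  (lookupℚ-genocchiList n k k<n)
... | inj₂ refl = refl

sumℚ-genocchiList : ∀ n → sumℚ n (λ k → ℕtoℚ (suc n C k) * lookupℚ (genocchiList (suc n)) k)
                           ≡ binomialSumBelow G (suc n)
sumℚ-genocchiList n =
  sumℚ-cong n (λ k k≤n → cong (ℕtoℚ (suc n C k) *_) (lookupℚ-genocchiList (suc n) k (s≤s k≤n)))

genocchi-rec : ∀ n → G n ≡ ½ * (2t n - binomialSumBelow G n)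
genocchi-rec zero          = refl
genocchi-rec (suc zero)    = trans (G-lookup 1) (trans (lookupℚ-snoc (genocchiList 1) _ (genocchiList-length 1))
  (cong (λ s → ½ * (2t 1 - s)) (sumℚ-genocchiList 0)))
genocchi-rec (suc (suc n)) = trans (G-lookup (2 ℕ.+ n))
  (trans (lookupℚ-snoc (genocchiList (2 ℕ.+ n)) _ (genocchiList-length (2 ℕ.+ n)))
  (cong (λ s → ½ * (0ℚ - s)) (sumℚ-genocchiList (suc n))))

genocchi-⊛[eᵗ+1] : G ⊛[eᵗ+1] ≗ 2t
genocchi-⊛[eᵗ+1] n = begin
    (G ⊛[eᵗ+1]) n                          ≡⟨ ⊛[eᵗ+1]-split G n ⟩
    s + (G n + G n)                        ≡⟨ cong (λ g → s + (g + g)) (genocchi-rec n) ⟩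
    s + (½ * (2t n - s) + ½ * (2t n - s))  ≡⟨ solve 2 (λ s d → s :+ (con ½ :* (d :- s) :+ con ½ :* (d :- s)) := d) refl s (2t n) ⟩
    2t n                                   ∎
  where
  open ≡-Reasoning
  s = binomialSumBelow G n

-- The sign (-1)ʲ in Defs' Z is local to a where block (taking the clause's k and m as extra
-- arguments); these metas name it by unifying with the unfolding of Z.
mutual
  Z-increment : ℕ → ℕ → ℤ
  Z-increment = _

  Z-suc : ∀ k M → Z k (suc M) ≡ Z k M ℤ.+ Z-increment k M
  Z-suc k M = refl

mutual
  Z-increment′ : ℕ → ℕ → ℕ → ℤ
  Z-increment′ = _

  Z-increment-suc² : ∀ k j → Z-increment k (suc (suc j)) ≡ Z-increment′ k (suc (suc j)) j
  Z-increment-suc² k j with suc (suc j)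
  ... | _ = refl

Z-increment-diagonal : ∀ k M → Z-increment k M ≡ Z-increment′ k M M
Z-increment-diagonal k zero          = refl
Z-increment-diagonal k (suc zero)    = refl
Z-increment-diagonal k (suc (suc j)) = Z-increment-suc² k j

ℤtoℚ-Z-increment′ : ∀ k m j → ℤtoℚ (Z-increment′ k m j) ≡ (- 1ℚ) ^ j * ℕtoℚ (suc m ℕ.^ k)
ℤtoℚ-Z-increment′ k m zero          = ℤtoℚ-homo-* (+ 1) (+ (suc m ℕ.^ k))
ℤtoℚ-Z-increment′ k m (suc zero)    = ℤtoℚ-homo-* (ℤ.- (+ 1)) (+ (suc m ℕ.^ k))
ℤtoℚ-Z-increment′ k m (suc (suc j)) = trans (ℤtoℚ-Z-increment′ k m j)
  (solve 2 (λ s x → s :* x := con (- 1ℚ) :* (con (- 1ℚ) :* s) :* x) refl ((- 1ℚ) ^ j) (ℕtoℚ (suc m ℕ.^ k)))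

-1^[q*2]≡1 : ∀ q → (- 1ℚ) ^ (q ℕ.* 2) ≡ 1ℚ
-1^[q*2]≡1 zero    = refl
-1^[q*2]≡1 (suc q) = trans
  (solve 1 (λ s → con (- 1ℚ) :* (con (- 1ℚ) :* s) := s) refl ((- 1ℚ) ^ (q ℕ.* 2)))
  (-1^[q*2]≡1 q)

Zseq : ℕ → Seq
Zseq M k = ℤtoℚ (Z k M)

Zseq-suc : ∀ M → Zseq (suc M) ≗ Zseq M ⊕ ((- 1ℚ) ^ M) · expSeq (ℕtoℚ (suc M))
Zseq-suc M k = begin
    Zseq (suc M) k                                   ≡⟨ cong ℤtoℚ (Z-suc k M) ⟩
    ℤtoℚ (Z k M ℤ.+ Z-increment k M)                 ≡⟨ ℤtoℚ-homo-+ (Z k M) (Z-increment k M) ⟩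
    Zseq M k + ℤtoℚ (Z-increment k M)                ≡⟨ cong (λ i → Zseq M k + ℤtoℚ i) (Z-increment-diagonal k M) ⟩
    Zseq M k + ℤtoℚ (Z-increment′ k M M)             ≡⟨ cong (_+_ (Zseq M k)) (ℤtoℚ-Z-increment′ k M M) ⟩
    Zseq M k + (- 1ℚ) ^ M * ℕtoℚ (suc M ℕ.^ k)       ≡⟨ cong (λ p → Zseq M k + (- 1ℚ) ^ M * p) (ℕtoℚ-homo-^ (suc M) k) ⟩
    Zseq M k + (- 1ℚ) ^ M * ℕtoℚ (suc M) ^ k         ∎
  where open ≡-Reasoning

⊛[eᵗ+1]-cong : ∀ {f g} → f ≗ g → f ⊛[eᵗ+1] ≗ g ⊛[eᵗ+1]
⊛[eᵗ+1]-cong f≗g n = cong₂ _+_ (⊛-cong {g = expSeq 1ℚ} f≗g (λ _ → refl) n) (f≗g n)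

Zseq-⊛[eᵗ+1] : ∀ M → Zseq M ⊛[eᵗ+1] ≗ expSeq 1ℚ ⊕ ((- 1ℚ) ^ suc M) · expSeq (ℕtoℚ (suc M))
Zseq-⊛[eᵗ+1] zero n = begin
    (Zseq 0 ⊛ expSeq 1ℚ) n + 0ℚ
  ≡⟨ cong (_+ 0ℚ) (trans (⊛-cong {g = expSeq 1ℚ} (λ k → sym (ℚP.*-zeroˡ (expSeq 1ℚ k))) (λ _ → refl) n)
                         (⊛-·ˡ 0ℚ (expSeq 1ℚ) (expSeq 1ℚ) n)) ⟩
    0ℚ * (expSeq 1ℚ ⊛ expSeq 1ℚ) n + 0ℚ
  ≡⟨ solve 2 (λ a p → con 0ℚ :* a :+ con 0ℚ := p :+ (con (- 1ℚ) :* con 1ℚ) :* p) refl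
       ((expSeq 1ℚ ⊛ expSeq 1ℚ) n) (1ℚ ^ n) ⟩
    1ℚ ^ n + (- 1ℚ) ^ 1 * 1ℚ ^ n
  ∎
  where open ≡-Reasoning
Zseq-⊛[eᵗ+1] (suc M) n = begin
    (Zseq (suc M) ⊛[eᵗ+1]) n
  ≡⟨ ⊛[eᵗ+1]-cong (Zseq-suc M) n ⟩
    ((Zseq M ⊕ s · expSeq μ) ⊛[eᵗ+1]) n
  ≡⟨ trans (⊛[eᵗ+1]-⊕ (Zseq M) (s · expSeq μ) n) (cong (_+_ ((Zseq M ⊛[eᵗ+1]) n)) (⊛[eᵗ+1]-· s (expSeq μ) n)) ⟩
    (Zseq M ⊛[eᵗ+1]) n + s * (expSeq μ ⊛[eᵗ+1]) n
  ≡⟨ cong₂ (λ a b → a + s * b) (Zseq-⊛[eᵗ+1] M n) (expSeq-⊛[eᵗ+1] μ n) ⟩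
    (1ℚ ^ n + (- 1ℚ) * s * μ ^ n) + s * ((μ + 1ℚ) ^ n + μ ^ n)
  ≡⟨ solve 4 (λ e s a b → (e :+ con (- 1ℚ) :* s :* a) :+ s :* (b :+ a) := e :+ con (- 1ℚ) :* (con (- 1ℚ) :* s) :* b) refl
       (1ℚ ^ n) s (μ ^ n) ((μ + 1ℚ) ^ n) ⟩
    1ℚ ^ n + (- 1ℚ) ^ suc (suc M) * (μ + 1ℚ) ^ n
  ≡⟨ cong (λ x → 1ℚ ^ n + (- 1ℚ) ^ suc (suc M) * x ^ n)
       (trans (ℚP.+-comm μ 1ℚ) (sym (ℕtoℚ-homo-+ 1 (suc M)))) ⟩
    1ℚ ^ n + (- 1ℚ) ^ suc (suc M) * ℕtoℚ (suc (suc M)) ^ n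
  ∎
  where
  open ≡-Reasoning
  s = (- 1ℚ) ^ M
  μ = ℕtoℚ (suc M)

dilate-genocchi-⊛-Zseq : ∀ M → (- 1ℚ) ^ M ≡ 1ℚ →
  dilate (ℕtoℚ (suc M)) G ⊛ Zseq M ≗ dilate (ℕtoℚ (suc M)) G ⊕ (- ℕtoℚ (suc M)) · G
dilate-genocchi-⊛-Zseq M even = ⊛[eᵗ+1]-injective λ n → begin
    ((a ⊛ Zseq M) ⊛[eᵗ+1]) n
  ≡⟨ ⊛-⊛[eᵗ+1] a (Zseq M) n ⟩
    (a ⊛ (Zseq M ⊛[eᵗ+1])) n
  ≡⟨ ⊛-cong {f = a} (λ _ → refl) (Zseq-⊛[eᵗ+1] M) n ⟩
    (a ⊛ (expSeq 1ℚ ⊕ ((- 1ℚ) ^ suc M) · expSeq μ)) n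
  ≡⟨ trans (⊛-distribˡ-⊕ a (expSeq 1ℚ) (((- 1ℚ) ^ suc M) · expSeq μ) n)
           (cong (_+_ ((a ⊛ expSeq 1ℚ) n)) (⊛-·ʳ ((- 1ℚ) ^ suc M) a (expSeq μ) n)) ⟩
    (a ⊛ expSeq 1ℚ) n + (- 1ℚ) * (- 1ℚ) ^ M * (a ⊛ expSeq μ) n
  ≡⟨ cong (λ s → (a ⊛ expSeq 1ℚ) n + (- 1ℚ) * s * (a ⊛ expSeq μ) n) even ⟩
    (a ⊛ expSeq 1ℚ) n + (- 1ℚ) * 1ℚ * (a ⊛ expSeq μ) n
  ≡⟨ solve 3 (λ A B x → A :+ con (- 1ℚ) :* con 1ℚ :* B := (A :+ x) :+ con (- 1ℚ) :* (B :+ x)) refl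
       ((a ⊛ expSeq 1ℚ) n) ((a ⊛ expSeq μ) n) (a n) ⟩
    (a ⊛[eᵗ+1]) n + (- 1ℚ) * ((a ⊛ expSeq μ) n + a n)
  ≡⟨ cong (λ x → (a ⊛[eᵗ+1]) n + (- 1ℚ) * x) (dilated-genocchi n) ⟩
    (a ⊛[eᵗ+1]) n + (- 1ℚ) * (μ * 2t n)
  ≡⟨ solve 3 (λ A m d → A :+ con (- 1ℚ) :* (m :* d) := A :+ (:- m) :* d) refl ((a ⊛[eᵗ+1]) n) μ (2t n) ⟩
    (a ⊛[eᵗ+1]) n + (- μ) * 2t n
  ≡⟨ cong (λ x → (a ⊛[eᵗ+1]) n + (- μ) * x) (sym (genocchi-⊛[eᵗ+1] n)) ⟩
    (a ⊛[eᵗ+1]) n + (- μ) * (G ⊛[eᵗ+1]) n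
  ≡⟨ sym (trans (⊛[eᵗ+1]-⊕ a ((- μ) · G) n) (cong (_+_ ((a ⊛[eᵗ+1]) n)) (⊛[eᵗ+1]-· (- μ) G n))) ⟩
    ((a ⊕ (- μ) · G) ⊛[eᵗ+1]) n
  ∎
  where
  open ≡-Reasoning
  μ = ℕtoℚ (suc M)
  a = dilate μ G
  dilated-genocchi : ∀ n → (a ⊛ expSeq μ) n + a n ≡ μ * 2t n
  dilated-genocchi n = trans (dilate-⊛[eᵗ+1] μ G n)
    (trans (cong (μ ^ n *_) (genocchi-⊛[eᵗ+1] n)) (dilate-2t μ n))

odd⇒≡suc[[m/2]*2] : ∀ m → m % 2 ≡ 1 → m ≡ suc (m / 2 ℕ.* 2)
odd⇒≡suc[[m/2]*2] m m-odd = trans (m≡m%n+[m/n]*n m 2) (cong (ℕ._+ (m / 2 ℕ.* 2)) m-odd)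

corollary2p12 : (m n : ℕ) → m % 2 ≡ 1 →
    (ℕtoℚ (m ℕ.^ n) ℚ.- ℕtoℚ m) ℚ.* G n
      ≡ sumℚ n (λ k → ℕtoℚ (n C k) ℚ.* ℕtoℚ (m ℕ.^ k) ℚ.* G k ℚ.* ℤtoℚ (Z (n ∸ k) (m ∸ 1)))
corollary2p12 m n m-odd with m / 2 | odd⇒≡suc[[m/2]*2] m m-odd
... | q | refl = begin
    (ℕtoℚ (m ℕ.^ n) - μ) * G n
  ≡⟨ cong (λ p → (p - μ) * G n) (ℕtoℚ-homo-^ m n) ⟩
    (μ ^ n - μ) * G n
  ≡⟨ solve 3 (λ p m g → (p :- m) :* g := p :* g :+ (:- m) :* g) refl (μ ^ n) μ (G n) ⟩
    (dilate μ G ⊕ (- μ) · G) n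
  ≡⟨ sym (dilate-genocchi-⊛-Zseq (q ℕ.* 2) (-1^[q*2]≡1 q) n) ⟩
    (dilate μ G ⊛ Zseq (q ℕ.* 2)) n
  ≡⟨ sumℚ-cong n (λ k _ → cong (_* Zseq (q ℕ.* 2) (n ∸ k)) (begin
       ℕtoℚ (n C k) * (μ ^ k * G k)       ≡⟨ ℚP.*-assoc (ℕtoℚ (n C k)) (μ ^ k) (G k) ⟨
       ℕtoℚ (n C k) * μ ^ k * G k         ≡⟨ cong (λ p → ℕtoℚ (n C k) * p * G k) (ℕtoℚ-homo-^ m k) ⟨
       ℕtoℚ (n C k) * ℕtoℚ (m ℕ.^ k) * G k ∎)) ⟩
    sumℚ n (λ k → ℕtoℚ (n C k) * ℕtoℚ (m ℕ.^ k) * G k * ℤtoℚ (Z (n ∸ k) (q ℕ.* 2)))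
  ∎
  where
  open ≡-Reasoning
  μ = ℕtoℚ m
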